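{- Let $A$ be an $\varepsilon$NFA and let $C$ be a state of $\mathrm{cond}(A_{\mathrm{sup}})$. Assume that a string $u=u[1]\cdots u[|u|]\in\Sigma^*$ can be read by $\mathrm{cond}(A_{\mathrm{sup}})$ starting in $C$ and following the sequence of transitions $(C,u[1],C),(C,u[2],C),\dots,(C,u[|u|],C)$. Then for any two states $p,q$ of $A_{\mathrm{sup}}$ belonging to $C$, there is a path in $A_{\mathrm{sup}}$ from $p$ to $q$ labelled with $u$ (ignoring $\varepsilon$-labels).
   Context: An $\varepsilon$NFA is a tuple $A=(Q,\Sigma,q_0,q_f,\delta)$ with $\delta\subseteq Q\times(\Sigma\cup\{\varepsilon\})\times Q$. $A_{\mathrm{sup}}$ is obtained from $A$ by adding a transition $(p,\varepsilon,q)$ for every transition $(p,b,q)$ of $A$ with $b\in\Sigma$. For an $\varepsilon$NFA $B$ viewed as a directed graph on its states, $\mathrm{SCC}_B[p]$ is the strongly connected component containing $p$; the condensation $\mathrm{cond}(B)$ has the SCCs of $B$ as states and a transition $(\mathrm{SCC}_B[p],a,\mathrm{SCC}_B[q])$ for every transition $(p,a,q)$ of $B$, with initial state $\mathrm{SCC}_B[q_0]$ and final state $\mathrm{SCC}_B[q_f]$. -}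

module Defs where

open import Level using (Level; 0ℓ)
open import Data.Nat using (ℕ)
open import Data.Fin using (Fin)
open import Data.Maybe using (Maybe; just; nothing)
open import Data.List using (List; []; _∷_)
open import Data.Product using (Σ; ∃; ∃-syntax; _×_; _,_)
open import Function.Bundles using (_⇔_)
open import Relation.Binary.Construct.Closure.ReflexiveTransitive using (Star)

-- An εNFA with finitely many states Fin n over alphabet Σ.
-- Labels are Maybe Σ, with nothing standing for ε.
record εNFA (Σ' : Set) : Set₁ where
  field
    n  : ℕ
    q₀ : Fin n
    qf : Fin n
    δ  : Fin n → Maybe Σ' → Fin n → Set

module _ {Σ' : Set} (A : εNFA Σ') where
  open εNFA A

  data δsup : Fin n → Maybe Σ' → Fin n → Set where
    orig   : ∀ {p a q} → δ p a q → δsup p a q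
    addEps : ∀ {p b q} → δ p (just b) q → δsup p nothing q

  Edge : Fin n → Fin n → Set
  Edge p q = ∃[ a ] δsup p a q

  Reach : Fin n → Fin n → Set
  Reach = Star Edge

  SameSCC : Fin n → Fin n → Set
  SameSCC p q = Reach p q × Reach q p

  -- C (a set of states of A_sup) is a strongly connected component,
  -- i.e. a state of cond(A_sup): C = SCC[r] for some r.
  IsSCC : (Fin n → Set) → Set
  IsSCC C = ∃[ r ] (∀ p → C p ⇔ SameSCC r p)

  CondTrans : (Fin n → Set) → Maybe Σ' → (Fin n → Set) → Set
  CondTrans C a D = ∃[ p ] ∃[ q ] (C p × D q × δsup p a q)

  data CondLoopRun (C : Fin n → Set) : List Σ' → Set where
    []  : CondLoopRun C []
    _∷_ : ∀ {b w} → CondTrans C (just b) C → CondLoopRun C w → CondLoopRun C (b ∷ w)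

  data Path : Fin n → List Σ' → Fin n → Set where
    here : ∀ {p} → Path p [] p
    εstep : ∀ {p r w q} → δsup p nothing r → Path r w q → Path p w q
    bstep : ∀ {p b r w q} → δsup p (just b) r → Path r w q → Path p (b ∷ w) q

-- Every edge of A_sup can be taken as an ε-step, since A_sup contains an ε-copy of each
-- lettered transition; so reachability inside C costs no letters. Reading u then amounts
-- to walking inside C to the source of the transition for u[1], taking it, and recursing
-- from its target, which again lies in C.
module Submission where

open import Defs
open import Data.Fin using (Fin)
open import Data.List using (List; []; _∷_)
open import Data.Maybe using (just; nothing)
open import Data.Product using (_,_; proj₁; proj₂)
open import Function.Bundles using (Equivalence)
open import Relation.Binary.Construct.Closure.ReflexiveTransitive using (ε; _◅_; _◅◅_)

module _ {Σ' : Set} (A : εNFA Σ') where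
  open εNFA A

  edge⇒εTransition : ∀ {p q} → Edge A p q → δsup A p nothing q
  edge⇒εTransition (nothing , orig d)   = orig d
  edge⇒εTransition (just _  , orig d)   = addEps d
  edge⇒εTransition (nothing , addEps d) = addEps d

  Reach-Path-trans : ∀ {p r w q} → Reach A p r → Path A r w q → Path A p w q
  Reach-Path-trans ε        path = path
  Reach-Path-trans (e ◅ es) path = εstep (edge⇒εTransition e) (Reach-Path-trans es path)

  IsSCC⇒Reach : ∀ {C} → IsSCC A C → ∀ {p q} → C p → C q → Reach A p q
  IsSCC⇒Reach (_ , C⇔SCC[r]) cp cq =
    proj₂ (Equivalence.to (C⇔SCC[r] _) cp) ◅◅ proj₁ (Equivalence.to (C⇔SCC[r] _) cq)

proposition4p4 : {Σ' : Set} (A : εNFA Σ') (C : Fin (εNFA.n A) → Set) →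
                 IsSCC A C → (u : List Σ') → CondLoopRun A C u →
                 ∀ p q → C p → C q → Path A p u q
proposition4p4 A C scc [] [] p q cp cq =
  Reach-Path-trans A (IsSCC⇒Reach A scc cp cq) here
proposition4p4 A C scc (b ∷ w) ((s , t , cs , ct , s-b→t) ∷ run) p q cp cq =
  Reach-Path-trans A (IsSCC⇒Reach A scc cp cs)
    (bstep s-b→t (proposition4p4 A C scc w run t q ct cq))
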